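{- If $G$ is a $2$-edge-connected graph of order $n$, then $\mathrm{prf}(G)\ge \frac{3n-3}{2}$.
   Context: An ordering of a graph $G=(V,E)$ is a bijection $\alpha:V\to\{1,\dots,|V|\}$. With $N[v]=\{v\}\cup\{u: uv\in E\}$, the profile of $\alpha$ is $\mathrm{prf}_\alpha(G)=\sum_{v\in V}\big(\alpha(v)-\min\{\alpha(u): u\in N[v]\}\big)$, and the profile of $G$ is $\mathrm{prf}(G)=\min_\alpha \mathrm{prf}_\alpha(G)$ over all orderings $\alpha$ of $G$. -}

module Defs where

open import Data.Nat using (ℕ; zero; suc; _+_; _∸_; _⊓_)
open import Data.Bool using (Bool; true; false; if_then_else_)
open import Data.Fin using (Fin; toℕ)
open import Data.Fin.Permutation using (Permutation′; _⟨$⟩ʳ_)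
open import Data.List using (List; foldr; map; allFin)
open import Data.Nat.ListAction using (sum)
open import Data.Product using (Σ; _×_; _,_)
open import Relation.Binary.PropositionalEquality using (_≡_)
open import Data.Bool using (T)

record Graph (n : ℕ) : Set where
  field
    adj   : Fin n → Fin n → Bool
    sym   : ∀ u v → adj u v ≡ adj v u
    irrefl : ∀ v → adj v v ≡ false
open Graph public

deleteEdge : ∀ {n} → Graph n → Fin n → Fin n → Graph n
deleteEdge {n} G a b = record
  { adj = adj′ ; sym = sym′ ; irrefl = irr′ }
  where
  open import Data.Fin using (_≟_)
  open import Relation.Nullary using (yes; no)
  open import Relation.Binary.PropositionalEquality using (refl)
  isAB : Fin n → Fin n → Bool
  isAB u v with u ≟ a | v ≟ b | u ≟ b | v ≟ a
  ... | yes _ | yes _ | _ | _ = true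
  ... | _ | _ | yes _ | yes _ = true
  ... | _ | _ | _ | _ = false
  adj′ : Fin n → Fin n → Bool
  adj′ u v = if isAB u v then false else adj G u v
  isAB-sym : ∀ u v → isAB u v ≡ isAB v u
  isAB-sym u v with u ≟ a | v ≟ b | u ≟ b | v ≟ a
  ... | yes _ | yes _ | yes _ | yes _ = refl
  ... | yes _ | yes _ | yes _ | no _ = refl
  ... | yes _ | yes _ | no _ | yes _ = refl
  ... | yes _ | yes _ | no _ | no _ = refl
  ... | yes _ | no _ | yes _ | yes _ = refl
  ... | yes _ | no _ | yes _ | no _ = refl
  ... | yes _ | no _ | no _ | yes _ = refl
  ... | yes _ | no _ | no _ | no _ = refl
  ... | no _ | yes _ | yes _ | yes _ = refl
  ... | no _ | yes _ | yes _ | no _ = refl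
  ... | no _ | yes _ | no _ | yes _ = refl
  ... | no _ | yes _ | no _ | no _ = refl
  ... | no _ | no _ | yes _ | yes _ = refl
  ... | no _ | no _ | yes _ | no _ = refl
  ... | no _ | no _ | no _ | yes _ = refl
  ... | no _ | no _ | no _ | no _ = refl
  sym′ : ∀ u v → adj′ u v ≡ adj′ v u
  sym′ u v rewrite isAB-sym u v | Graph.sym G u v = refl
  irr′ : ∀ v → adj′ v v ≡ false
  irr′ v with isAB v v
  ... | true = refl
  ... | false = Graph.irrefl G v

data Reachable {n : ℕ} (G : Graph n) : Fin n → Fin n → Set where
  here : ∀ {v} → Reachable G v v
  step : ∀ {u v w} → T (adj G u v) → Reachable G v w → Reachable G u w

Connected : ∀ {n} → Graph n → Set
Connected G = ∀ u v → Reachable G u v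

TwoEdgeConnected : ∀ {n} → Graph n → Set
TwoEdgeConnected {n} G =
  2 Data.Nat.≤ n × Connected G ×
  (∀ a b → T (adj G a b) → Connected (deleteEdge G a b))

-- An ordering is a bijection V → {1,…,n}; we use Fin n (positions 0..n-1),
-- which shifts every position by 1 and leaves all differences unchanged.
Ordering : ℕ → Set
Ordering n = Permutation′ n

pos : ∀ {n} → Ordering n → Fin n → ℕ
pos α v = toℕ (α ⟨$⟩ʳ v)

minClosedNbhd : ∀ {n} → Graph n → Ordering n → Fin n → ℕ
minClosedNbhd G α v =
  foldr (λ u m → if adj G v u then pos α u ⊓ m else m) (pos α v) (allFin _)

profileOf : ∀ {n} → Graph n → Ordering n → ℕ
profileOf G α = sum (map (λ v → pos α v ∸ minClosedNbhd G α v) (allFin _))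

IsProfile : ∀ {n} → Graph n → ℕ → Set
IsProfile G p = Σ (Ordering _) (λ α → profileOf G α ≡ p)
              × (∀ α → p Data.Nat.≤ profileOf G α)

{-# OPTIONS --safe #-}
-- Read the profile column by column.  The profile of α is the total length
-- of the intervals [min α(N[v]), α(v)), so it is the sum over positions k of
-- the width w_k: the number of vertices after position k with a neighbour at
-- or before k.  In a 2-edge-connected graph every vertex has two neighbours
-- and every proper initial segment of α is left by two distinct edges.  Hence
-- w_0 ≥ 2, w_k ≥ 1 for k < n - 1, and no two consecutive widths w_k, w_(k+1)
-- with k < n - 2 are both 1.  Summing, 2 (w_0 + … + w_(n-1)) ≥ 3 (n - 1).
module Submission where

open import Defs hiding (sym)
open import Data.Nat using (ℕ; zero; suc; _+_; _*_; _∸_; _⊓_; _≤_; _<_; z≤n; s≤s; _≤?_; _<?_)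
open import Data.Nat.Properties hiding (_≟_)
open import Data.Nat.ListAction as List using ()
open import Algebra.Properties.CommutativeMonoid.Sum +-0-commutativeMonoid
  using (sum-syntax; ∑-distrib-+; sum-replicate-zero)
open import Data.Bool using (Bool; true; false; if_then_else_; T)
open import Data.Fin as Fin using (Fin; toℕ; fromℕ<; _≟_)
open import Data.Fin.Properties using (toℕ-injective; toℕ-fromℕ<)
open import Data.Fin.Permutation using (_⟨$⟩ʳ_; _⟨$⟩ˡ_; inverseʳ)
open import Data.List using (_∷_; foldr; map; tabulate; allFin)
open import Data.List.Properties using (map-tabulate)
open import Data.List.Relation.Unary.Any using (here; there)
open import Data.List.Membership.Propositional using (_∈_)
open import Data.List.Membership.Propositional.Properties using (∈-allFin)
open import Data.Product using (Σ-syntax; ∃-syntax; _×_; _,_; proj₁; proj₂)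
open import Data.Sum using (_⊎_; inj₁; inj₂)
open import Function using (_∘_; id)
open import Function.Bundles using (Injection)
open import Function.Properties.Inverse using (↔⇒↣)
open import Level using (0ℓ)
open import Relation.Binary.PropositionalEquality
open import Relation.Nullary using (¬_; yes; no; contradiction)
open import Relation.Unary using (Pred; Decidable)

sum-tabulate : ∀ {n} (f : Fin n → ℕ) → List.sum (tabulate f) ≡ ∑[ i < n ] f i
sum-tabulate {zero}  f = refl
sum-tabulate {suc n} f = cong (f Fin.zero +_) (sum-tabulate (f ∘ Fin.suc))

∑-mono-≤ : ∀ {n} {f g : Fin n → ℕ} → (∀ i → f i ≤ g i) → ∑[ i < n ] f i ≤ ∑[ i < n ] g i
∑-mono-≤ {zero}  f≤g = z≤n
∑-mono-≤ {suc n} f≤g = +-mono-≤ (f≤g Fin.zero) (∑-mono-≤ (f≤g ∘ Fin.suc))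

term≤∑ : ∀ {n} (f : Fin n → ℕ) i → f i ≤ ∑[ j < n ] f j
term≤∑ f Fin.zero    = m≤m+n _ _
term≤∑ f (Fin.suc i) = ≤-trans (term≤∑ (f ∘ Fin.suc) i) (m≤n+m _ _)

two-terms≤∑ : ∀ {n} (f : Fin n → ℕ) {i j} → i ≢ j → f i + f j ≤ ∑[ k < n ] f k
two-terms≤∑ f {Fin.zero}  {Fin.zero}  i≢j = contradiction refl i≢j
two-terms≤∑ f {Fin.zero}  {Fin.suc j} i≢j = +-monoʳ-≤ (f Fin.zero) (term≤∑ (f ∘ Fin.suc) j)
two-terms≤∑ f {Fin.suc i} {Fin.zero}  i≢j =
  subst (_≤ ∑[ k < _ ] f k) (+-comm (f Fin.zero) _) (+-monoʳ-≤ (f Fin.zero) (term≤∑ (f ∘ Fin.suc) i))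
two-terms≤∑ f {Fin.suc i} {Fin.suc j} i≢j =
  ≤-trans (two-terms≤∑ (f ∘ Fin.suc) (i≢j ∘ cong Fin.suc)) (m≤n+m _ _)

sumBelow : ℕ → (ℕ → ℕ) → ℕ
sumBelow zero    f = 0
sumBelow (suc n) f = sumBelow n f + f n

sumBelow-∑-comm : ∀ {n} N (f : Fin n → ℕ → ℕ) →
  sumBelow N (λ k → ∑[ i < n ] f i k) ≡ ∑[ i < n ] sumBelow N (f i)
sumBelow-∑-comm {n} zero    f = sym (sum-replicate-zero n)
sumBelow-∑-comm {n} (suc N) f =
  trans (cong (_+ ∑[ i < n ] f i N) (sumBelow-∑-comm N f))
        (sym (∑-distrib-+ (λ i → sumBelow N (f i)) (λ i → f i N)))

χ[_,_⟩ : ℕ → ℕ → ℕ → ℕ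
χ[ a , b ⟩ k with a ≤? k | k <? b
... | yes _ | yes _ = 1
... | _     | _     = 0

χ-inside : ∀ {a b k} → a ≤ k → k < b → χ[ a , b ⟩ k ≡ 1
χ-inside {a} {b} {k} a≤k k<b with a ≤? k | k <? b
... | yes _   | yes _   = refl
... | no  a≰k | _       = contradiction a≤k a≰k
... | yes _   | no  k≮b = contradiction k<b k≮b

sumBelow-χ      : ∀ a b N → sumBelow N χ[ a , b ⟩ ≤ (N ⊓ b) ∸ a
sumBelow-χ-step : ∀ a b N → sumBelow N χ[ a , b ⟩ + 0 ≤ (suc N ⊓ b) ∸ a

sumBelow-χ a b zero = z≤n
sumBelow-χ a b (suc N) with a ≤? N | N <? b
... | yes a≤N | yes N<b = begin
  sumBelow N χ[ a , b ⟩ + 1  ≤⟨ +-monoˡ-≤ 1 (sumBelow-χ a b N) ⟩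
  (N ⊓ b) ∸ a + 1           ≡⟨ cong (λ m → m ∸ a + 1) (m≤n⇒m⊓n≡m (<⇒≤ N<b)) ⟩
  N ∸ a + 1                 ≡⟨ +-comm (N ∸ a) 1 ⟩
  suc (N ∸ a)               ≡⟨ +-∸-assoc 1 a≤N ⟨
  suc N ∸ a                 ≡⟨ cong (_∸ a) (m≤n⇒m⊓n≡m N<b) ⟨
  (suc N ⊓ b) ∸ a           ∎
  where open ≤-Reasoning
... | no  _ | _     = sumBelow-χ-step a b N
... | yes _ | no  _ = sumBelow-χ-step a b N

sumBelow-χ-step a b N = begin
  sumBelow N χ[ a , b ⟩ + 0  ≡⟨ +-identityʳ _ ⟩
  sumBelow N χ[ a , b ⟩      ≤⟨ sumBelow-χ a b N ⟩
  (N ⊓ b) ∸ a               ≤⟨ ∸-monoˡ-≤ a (⊓-monoˡ-≤ b (n≤1+n N)) ⟩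
  (suc N ⊓ b) ∸ a           ∎
  where open ≤-Reasoning

sumBelow-χ≤ : ∀ a b N → sumBelow N χ[ a , b ⟩ ≤ b ∸ a
sumBelow-χ≤ a b N = ≤-trans (sumBelow-χ a b N) (∸-monoˡ-≤ a (m⊓n≤n N b))

module _ {n : ℕ} {c : ℕ → ℕ}
         (c₀≥2 : 2 ≤ c 0)
         (c≥1 : ∀ k → suc k < n → 1 ≤ c k)
         (c-pair≥2 : ∀ k → 2 + k < n → 2 ≤ c k ⊎ 2 ≤ c (suc k)) where

  private
    sumBelow-suc : ∀ j → 2 * sumBelow (suc j) c ≡ 2 * sumBelow j c + 2 * c j
    sumBelow-suc j = *-distribˡ-+ 2 (sumBelow j c) (c j)

    -- The bound gains 1 whenever the last term is at least 2; that credit pays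
    -- for a following term equal to 1.
    prefix-bound : ∀ j → suc j < n →
      3 * suc j ≤ 2 * sumBelow (suc j) c × (2 ≤ c j → 3 * suc j + 1 ≤ 2 * sumBelow (suc j) c)
    prefix-bound zero    _ = ≤-trans (n≤1+n 3) c₀-bound , λ _ → c₀-bound
      where
      c₀-bound : 4 ≤ 2 * (0 + c 0)
      c₀-bound = *-monoʳ-≤ 2 c₀≥2
    prefix-bound (suc j) j+2<n with 2 ≤? c (suc j)
    ... | yes cⱼ₊₁≥2 = ≤-trans (m≤m+n _ 1) bound , λ _ → bound
      where
      bound : 3 * suc (suc j) + 1 ≤ 2 * sumBelow (suc (suc j)) c
      bound = begin
        3 * suc (suc j) + 1               ≡⟨ cong (_+ 1) (*-suc 3 (suc j)) ⟩
        3 + 3 * suc j + 1                 ≡⟨ +-comm (3 + 3 * suc j) 1 ⟩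
        4 + 3 * suc j                     ≡⟨ +-comm 4 (3 * suc j) ⟩
        3 * suc j + 4                     ≤⟨ +-mono-≤ (proj₁ (prefix-bound j (<-trans (n<1+n _) j+2<n)))
                                                       (*-monoʳ-≤ 2 cⱼ₊₁≥2) ⟩
        2 * sumBelow (suc j) c + 2 * c (suc j) ≡⟨ sumBelow-suc (suc j) ⟨
        2 * sumBelow (suc (suc j)) c      ∎
        where open ≤-Reasoning
    ... | no cⱼ₊₁≱2 = bound , λ cⱼ₊₁≥2 → contradiction cⱼ₊₁≥2 cⱼ₊₁≱2
      where
      cⱼ≥2 : 2 ≤ c j
      cⱼ≥2 with c-pair≥2 j j+2<n
      ... | inj₁ cⱼ≥2   = cⱼ≥2
      ... | inj₂ cⱼ₊₁≥2 = contradiction cⱼ₊₁≥2 cⱼ₊₁≱2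
      bound : 3 * suc (suc j) ≤ 2 * sumBelow (suc (suc j)) c
      bound = begin
        3 * suc (suc j)                   ≡⟨ *-suc 3 (suc j) ⟩
        3 + 3 * suc j                     ≡⟨ +-comm 3 (3 * suc j) ⟩
        3 * suc j + 3                     ≡⟨ +-assoc (3 * suc j) 1 2 ⟨
        3 * suc j + 1 + 2                 ≤⟨ +-mono-≤ (proj₂ (prefix-bound j (<-trans (n<1+n _) j+2<n)) cⱼ≥2)
                                                       (*-monoʳ-≤ 2 (c≥1 (suc j) j+2<n)) ⟩
        2 * sumBelow (suc j) c + 2 * c (suc j) ≡⟨ sumBelow-suc (suc j) ⟨
        2 * sumBelow (suc (suc j)) c      ∎
        where open ≤-Reasoning

  3*n∸3≤2*sumBelow : 3 * n ∸ 3 ≤ 2 * sumBelow n c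
  3*n∸3≤2*sumBelow = bound n refl
    where
    bound : ∀ m → m ≡ n → 3 * m ∸ 3 ≤ 2 * sumBelow m c
    bound zero          _   = z≤n
    bound (suc zero)    _   = z≤n
    bound (suc (suc j)) m≡n = begin
      3 * suc (suc j) ∸ 3             ≡⟨ cong (_∸ 3) (*-suc 3 (suc j)) ⟩
      3 + 3 * suc j ∸ 3               ≡⟨ m+n∸m≡n 3 (3 * suc j) ⟩
      3 * suc j                       ≤⟨ proj₁ (prefix-bound j (subst (suc j <_) m≡n (n<1+n _))) ⟩
      2 * sumBelow (suc j) c          ≤⟨ *-monoʳ-≤ 2 (m≤m+n (sumBelow (suc j) c) (c (suc j))) ⟩
      2 * sumBelow (suc (suc j)) c    ∎
      where open ≤-Reasoning

adj⇒≢ : ∀ {n} (G : Graph n) {u v} → T (adj G u v) → u ≢ v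
adj⇒≢ G {u} uv refl = subst T (irrefl G u) uv

deleteEdge-⊆ : ∀ {n} (G : Graph n) a b {u v} → T (adj (deleteEdge G a b) u v) → T (adj G u v)
deleteEdge-⊆ G a b {u} {v} = if-false⇒ _
  where
  if-false⇒ : ∀ x → T (if x then false else adj G u v) → T (adj G u v)
  if-false⇒ false uv = uv

deleteEdge-removes : ∀ {n} (G : Graph n) a b → adj (deleteEdge G a b) a b ≡ false
deleteEdge-removes G a b with a ≟ a | b ≟ b
... | yes _   | yes _   = refl
... | no  a≢a | _       = contradiction refl a≢a
... | yes _   | no  b≢b = contradiction refl b≢b

record CrossingEdge {n} (G : Graph n) (S : Pred (Fin n) 0ℓ) : Set where
  field
    inner outer : Fin n
    edge        : T (adj G inner outer)
    inner∈S     : S inner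
    outer∉S     : ¬ S outer
open CrossingEdge

crossingEdge : ∀ {n} {G : Graph n} {S : Pred (Fin n) 0ℓ} → Decidable S →
  ∀ {u w} → Reachable G u w → S u → ¬ S w → CrossingEdge G S
crossingEdge S? here                 u∈S w∉S = contradiction u∈S w∉S
crossingEdge S? (step {v = v} uv vw) u∈S w∉S with S? v
... | yes v∈S = crossingEdge S? vw v∈S w∉S
... | no  v∉S = record { edge = uv ; inner∈S = u∈S ; outer∉S = v∉S }

twoCrossingEdges : ∀ {n} {G : Graph n} {S : Pred (Fin n) 0ℓ} → TwoEdgeConnected G → Decidable S →
  ∀ {u w} → S u → ¬ S w →
  Σ[ e ∈ CrossingEdge G S ] Σ[ e′ ∈ CrossingEdge G S ] ¬ (inner e ≡ inner e′ × outer e ≡ outer e′)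
twoCrossingEdges {G = G} (_ , connected , bridgeless) S? {u} {w} u∈S w∉S = e , e′ , e≢e′
  where
  e : CrossingEdge G _
  e = crossingEdge S? (connected u w) u∈S w∉S
  e₋ : CrossingEdge (deleteEdge G (inner e) (outer e)) _
  e₋ = crossingEdge S? (bridgeless (inner e) (outer e) (edge e) u w) u∈S w∉S
  e′ : CrossingEdge G _
  e′ = record { edge = deleteEdge-⊆ G (inner e) (outer e) (edge e₋)
             ; inner∈S = inner∈S e₋ ; outer∉S = outer∉S e₋ }
  e≢e′ : ¬ (inner e ≡ inner e′ × outer e ≡ outer e′)
  e≢e′ (inner≡ , outer≡) = subst T (deleteEdge-removes G (inner e) (outer e))
    (subst₂ (λ x y → T (adj (deleteEdge G (inner e) (outer e)) x y)) (sym inner≡) (sym outer≡) (edge e₋))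

anotherVertex : ∀ {n} → 2 ≤ n → (w : Fin n) → ∃[ v ] v ≢ w
anotherVertex (s≤s (s≤s _)) Fin.zero    = Fin.suc Fin.zero , λ ()
anotherVertex (s≤s (s≤s _)) (Fin.suc _) = Fin.zero , λ ()

twoNeighbours : ∀ {n} {G : Graph n} → TwoEdgeConnected G → ∀ w →
  Σ[ t ∈ Fin n ] Σ[ t′ ∈ Fin n ] T (adj G w t) × T (adj G w t′) × t ≢ t′
twoNeighbours {G = G} tec@(2≤n , _) w
  with v , v≢w    ← anotherVertex 2≤n w
  with e , e′ , e≢e′ ← twoCrossingEdges {S = _≡ w} tec (_≟ w) refl v≢w
  = outer e , outer e′ , edge-from-w e , edge-from-w e′
  , λ t≡t′ → e≢e′ (trans (inner∈S e) (sym (inner∈S e′)) , t≡t′)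
  where
  edge-from-w : (e : CrossingEdge G (_≡ w)) → T (adj G w (outer e))
  edge-from-w e = subst (λ x → T (adj G x (outer e))) (inner∈S e) (edge e)

foldr-⊓-≤ : ∀ {A : Set} (p : A → Bool) (f : A → ℕ) init {x xs} → x ∈ xs → T (p x) →
  foldr (λ y m → if p y then f y ⊓ m else m) init xs ≤ f x
foldr-⊓-≤ p f init {x} (here refl) px with p x
... | true = m⊓n≤m (f x) _
foldr-⊓-≤ p f init {xs = y ∷ _} (there x∈ys) px with p y
... | true  = ≤-trans (m⊓n≤n (f y) _) (foldr-⊓-≤ p f init x∈ys px)
... | false = foldr-⊓-≤ p f init x∈ys px

module Widths {n : ℕ} (G : Graph n) (α : Ordering n) where

  P : Fin n → ℕ
  P = pos α

  M : Fin n → ℕ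
  M = minClosedNbhd G α

  P-injective : ∀ {u v} → P u ≡ P v → u ≡ v
  P-injective = Injection.injective (↔⇒↣ α) ∘ toℕ-injective

  vertexAt : ∀ k → k < n → Fin n
  vertexAt k k<n = α ⟨$⟩ˡ fromℕ< k<n

  P-vertexAt : ∀ k (k<n : k < n) → P (vertexAt k k<n) ≡ k
  P-vertexAt k k<n = trans (cong toℕ (inverseʳ α)) (toℕ-fromℕ< k<n)

  M≤P-neighbour : ∀ {v u} → T (adj G v u) → M v ≤ P u
  M≤P-neighbour {v} {u} = foldr-⊓-≤ (adj G v) P (P v) (∈-allFin u)

  Active : ℕ → Fin n → Set
  Active k v = M v ≤ k × k < P v

  width : ℕ → ℕ
  width k = ∑[ v < n ] χ[ M v , P v ⟩ k

  sumBelow-width≤profile : sumBelow n width ≤ profileOf G α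
  sumBelow-width≤profile = begin
    sumBelow n width                          ≡⟨ sumBelow-∑-comm n (λ v → χ[ M v , P v ⟩) ⟩
    ∑[ v < n ] sumBelow n χ[ M v , P v ⟩       ≤⟨ ∑-mono-≤ (λ v → sumBelow-χ≤ (M v) (P v) n) ⟩
    ∑[ v < n ] (P v ∸ M v)                    ≡⟨ sum-tabulate (λ v → P v ∸ M v) ⟨
    List.sum (tabulate (λ v → P v ∸ M v))     ≡⟨ cong List.sum (map-tabulate id (λ v → P v ∸ M v)) ⟨
    profileOf G α                             ∎
    where open ≤-Reasoning

  1≤width : ∀ {k v} → Active k v → 1 ≤ width k
  1≤width {k} {v} (M≤k , k<P) =
    subst (_≤ width k) (χ-inside M≤k k<P) (term≤∑ (λ v → χ[ M v , P v ⟩ k) v)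

  2≤width : ∀ {k v w} → v ≢ w → Active k v → Active k w → 2 ≤ width k
  2≤width {k} v≢w (M≤k , k<P) (M≤k′ , k<P′) =
    subst (_≤ width k) (cong₂ _+_ (χ-inside M≤k k<P) (χ-inside M≤k′ k<P′))
      (two-terms≤∑ (λ v → χ[ M v , P v ⟩ k) v≢w)

  adj-sym : ∀ {x y} → T (adj G x y) → T (adj G y x)
  adj-sym {x} {y} = subst T (Graph.sym G x y)

  active-neighbour : ∀ {k x y} → T (adj G x y) → P x ≤ k → k < P y → Active k y
  active-neighbour xy Px≤k k<Py = ≤-trans (M≤P-neighbour (adj-sym xy)) Px≤k , k<Py

  Before : ℕ → Pred (Fin n) 0ℓ
  Before k v = P v ≤ k

  Before? : ∀ k → Decidable (Before k)
  Before? k v = P v ≤? k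

  active-outer : ∀ {k} (e : CrossingEdge G (Before k)) → Active k (outer e)
  active-outer e = active-neighbour (edge e) (inner∈S e) (≰⇒> (outer∉S e))

  active-outer-pred : ∀ {k} (e : CrossingEdge G (Before (suc k))) → P (inner e) ≢ suc k →
    Active k (outer e)
  active-outer-pred e Px≢1+k =
    active-neighbour (edge e) (m<1+n⇒m≤n (≤∧≢⇒< (inner∈S e) Px≢1+k)) (<⇒≤ (≰⇒> (outer∉S e)))

  module _ (tec : TwoEdgeConnected G) where

    private
      0<n : 0 < n
      0<n = ≤-trans (s≤s z≤n) (proj₁ tec)

      first : Fin n
      first = vertexAt 0 0<n

      P-first : P first ≡ 0
      P-first = P-vertexAt 0 0<n

      first∈Before : ∀ k → Before k first
      first∈Before k = subst (_≤ k) (sym P-first) z≤n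

      next∉Before : ∀ k (1+k<n : suc k < n) → ¬ Before k (vertexAt (suc k) 1+k<n)
      next∉Before k 1+k<n = <⇒≱ (subst (k <_) (sym (P-vertexAt (suc k) 1+k<n)) (n<1+n k))

      P-neighbour≢ : ∀ {v t} → T (adj G v t) → P v ≢ P t
      P-neighbour≢ vt = adj⇒≢ G vt ∘ P-injective

    2≤width-0 : 2 ≤ width 0
    2≤width-0 with t , t′ , ft , ft′ , t≢t′ ← twoNeighbours tec first =
      2≤width t≢t′ (active-neighbour ft (≤-reflexive P-first) (after ft))
                   (active-neighbour ft′ (≤-reflexive P-first) (after ft′))
      where
      after : ∀ {t} → T (adj G first t) → 0 < P t
      after ft = n≢0⇒n>0 (P-neighbour≢ ft ∘ trans P-first ∘ sym)

    1≤width-cut : ∀ k → suc k < n → 1 ≤ width k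
    1≤width-cut k 1+k<n = 1≤width (active-outer
      (crossingEdge (Before? k) (proj₁ (proj₂ tec) first _) (first∈Before k) (next∉Before k 1+k<n)))

    -- If the two edges leaving {P ≤ k + 1} end in the same vertex y, one of
    -- them starts at a position ≤ k, so y is active at k besides w.
    2≤width-pair-if-earlier : ∀ {k w t} → P w ≡ suc k → 2 + k < n → T (adj G w t) → P t ≤ k →
      2 ≤ width k ⊎ 2 ≤ width (suc k)
    2≤width-pair-if-earlier {k} {w} Pw≡1+k 2+k<n wt Pt≤k
      with e , e′ , e≢e′ ← twoCrossingEdges tec (Before? (suc k)) (first∈Before (suc k))
                                             (next∉Before (suc k) 2+k<n)
      with outer e ≟ outer e′
    ... | no  y≢y′ = inj₂ (2≤width y≢y′ (active-outer e) (active-outer e′))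
    ... | yes y≡y′ = inj₁ (2≤width w≢y w-active y-active)
      where
      w-active : Active k w
      w-active = active-neighbour (adj-sym wt) Pt≤k (subst (k <_) (sym Pw≡1+k) (n<1+n k))
      w≢y : w ≢ outer e
      w≢y refl = outer∉S e (≤-reflexive Pw≡1+k)
      y-active : Active k (outer e)
      y-active with inner e ≟ w
      ... | no  x≢w = active-outer-pred e (x≢w ∘ P-injective ∘ λ Px≡1+k → trans Px≡1+k (sym Pw≡1+k))
      ... | yes x≡w = subst (Active k) (sym y≡y′) (active-outer-pred e′
                        λ Px′≡1+k → e≢e′ (trans x≡w (P-injective (trans Pw≡1+k (sym Px′≡1+k))) , y≡y′))

    2≤width-pair-at : ∀ {k w} → P w ≡ suc k → 2 + k < n → 2 ≤ width k ⊎ 2 ≤ width (suc k)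
    2≤width-pair-at {k} {w} Pw≡1+k 2+k<n
      with t , t′ , wt , wt′ , t≢t′ ← twoNeighbours tec w
      with P t ≤? k | P t′ ≤? k
    ... | yes Pt≤k | _         = 2≤width-pair-if-earlier Pw≡1+k 2+k<n wt Pt≤k
    ... | no  _    | yes Pt′≤k = 2≤width-pair-if-earlier Pw≡1+k 2+k<n wt′ Pt′≤k
    ... | no  Pt≰k | no  Pt′≰k = inj₂ (2≤width t≢t′ (later wt Pt≰k) (later wt′ Pt′≰k))
      where
      later : ∀ {t} → T (adj G w t) → ¬ P t ≤ k → Active (suc k) t
      later wt Pt≰k = active-neighbour wt (≤-reflexive Pw≡1+k)
        (≤∧≢⇒< (≰⇒> Pt≰k) (P-neighbour≢ wt ∘ trans Pw≡1+k))

    2≤width-pair : ∀ k → 2 + k < n → 2 ≤ width k ⊎ 2 ≤ width (suc k)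
    2≤width-pair k 2+k<n = 2≤width-pair-at (P-vertexAt (suc k) (<⇒≤ 2+k<n)) 2+k<n

theorem2p5 : ∀ (n : ℕ) (G : Graph n) → TwoEdgeConnected G →
    ∀ (p : ℕ) → IsProfile G p → 3 * n ∸ 3 ≤ 2 * p
theorem2p5 n G tec p ((α , prf≡p) , _) = begin
  3 * n ∸ 3              ≤⟨ 3*n∸3≤2*sumBelow (2≤width-0 tec) (1≤width-cut tec) (2≤width-pair tec) ⟩
  2 * sumBelow n width   ≤⟨ *-monoʳ-≤ 2 sumBelow-width≤profile ⟩
  2 * profileOf G α      ≡⟨ cong (2 *_) prf≡p ⟩
  2 * p                  ∎
  where
  open ≤-Reasoning
  open Widths G α
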